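{- Let $n\ge 1$, $p\ge1$, and let $w=[i_1,j_1][i_2,j_2]\cdots[i_p,j_p]$ be a thick fully commutative element of size $p$ in $W(A_n)$ (in canonical form). Then $\bar w=[i_1,j_1-1][i_2,j_2-1]\cdots[i_p,j_p-1]$ is (the canonical form of) a fully commutative element of size $p$ in $W(A_{n-1})$, the map $w\mapsto\bar w$ is a bijection from the set $A^{G,p}_n$ of thick elements of size $p$ in $W(A_n)$ onto the set $A^{c,p}_{n-1}$ of FC elements of size $p$ in $W(A_{n-1})$, and $\ell(w)=\ell(\bar w)+p$. Consequently $w\mapsto \bar w$ is a size-preserving bijection from the set $A^G_n$ of thick elements of $W(A_n)$ onto $A^c_{n-1}\setminus\{1\}$.
   Context: $W(A_n)$: Coxeter group with generators $\sigma_1,\dots,\sigma_n$ of type $A_n$ ($W(A_0)=1$); $\ell$ is length. FC (fully commutative) = any two reduced expressions are related by commutations only. $[i,j]=\sigma_i\cdots\sigma_j$. Every FC element has a unique canonical form $[i_1,j_1]\cdots[i_p,j_p]$ with $n\ge j_1>\cdots>j_p\ge 1$, $n\ge i_1>\cdots>i_p\ge1$, $j_t\ge i_t$; $p$ is the size. An FC element of size $p>0$ is thick if $j_t>i_t$ for all $1\le t\le p$. $A^c_n$ is the set of FC elements of $W(A_n)$, $A^{c,p}_n$ those of size $p$; sets with index $n\le0$ or $p\le 0$ of thick elements are empty. -}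

module Defs where

open import Data.Nat using (ℕ; zero; suc; _+_; _∸_; _≤_; _<_)
open import Data.List using (List; []; _∷_; _++_; map; concatMap; upTo; length)
open import Data.List.Relation.Unary.All using (All)
open import Data.List.Relation.Unary.Linked using (Linked)
open import Data.Product using (_×_; _,_; Σ; proj₁; proj₂)
open import Relation.Binary.PropositionalEquality using (_≡_)

-- The Coxeter group W(A_n), presented by words in the generators
-- σ_1, …, σ_n (a generator σ_a is encoded by the natural number a).

Gen : ℕ → ℕ → Set
Gen n a = (1 ≤ a) × (a ≤ n)

ValidWord : ℕ → List ℕ → Set
ValidWord n u = All (Gen n) u

data CoxRel (n : ℕ) : List ℕ → List ℕ → Set where
  quad  : ∀ a → Gen n a → CoxRel n (a ∷ a ∷ []) []
  comm  : ∀ a b → Gen n a → Gen n b → suc a < b →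
          CoxRel n (a ∷ b ∷ []) (b ∷ a ∷ [])
  braid : ∀ a → Gen n a → Gen n (suc a) →
          CoxRel n (a ∷ suc a ∷ a ∷ []) (suc a ∷ a ∷ suc a ∷ [])

data CommRel (n : ℕ) : List ℕ → List ℕ → Set where
  comm  : ∀ a b → Gen n a → Gen n b → suc a < b →
          CommRel n (a ∷ b ∷ []) (b ∷ a ∷ [])

data Congr (R : List ℕ → List ℕ → Set) : List ℕ → List ℕ → Set where
  step  : ∀ x u v y → R u v → Congr R (x ++ u ++ y) (x ++ v ++ y)
  refl  : ∀ u → Congr R u u
  sym   : ∀ {u v} → Congr R u v → Congr R v u
  trans : ∀ {u v w} → Congr R u v → Congr R v w → Congr R u w

_≈⟨_⟩_ : List ℕ → ℕ → List ℕ → Set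
u ≈⟨ n ⟩ v = Congr (CoxRel n) u v

_≈comm⟨_⟩_ : List ℕ → ℕ → List ℕ → Set
u ≈comm⟨ n ⟩ v = Congr (CommRel n) u v

Reduced : ℕ → List ℕ → List ℕ → Set
Reduced n u v = ValidWord n v × (u ≈⟨ n ⟩ v) ×
  (∀ v' → ValidWord n v' → u ≈⟨ n ⟩ v' → length v ≤ length v')

HasLength : ℕ → List ℕ → ℕ → Set
HasLength n u k = Σ (List ℕ) λ v → Reduced n u v × length v ≡ k

IsFC : ℕ → List ℕ → Set
IsFC n u = ∀ v v' → Reduced n u v → Reduced n u v' → v ≈comm⟨ n ⟩ v'

-- Canonical forms [i_1,j_1]⋯[i_p,j_p], encoded as the list of pairs (i_t , j_t).

-- [i,j] = σ_i σ_{i+1} ⋯ σ_j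
seg : ℕ × ℕ → List ℕ
seg (i , j) = map (i +_) (upTo (suc (j ∸ i)))

word : List (ℕ × ℕ) → List ℕ
word = concatMap seg

SegOK : ℕ → ℕ × ℕ → Set
SegOK n (i , j) = (1 ≤ i) × (i ≤ j) × (j ≤ n)

Decr : ℕ × ℕ → ℕ × ℕ → Set
Decr (i , j) (i' , j') = (i' < i) × (j' < j)

IsCanon : ℕ → ℕ → List (ℕ × ℕ) → Set
IsCanon n p l = (length l ≡ p) × All (SegOK n) l × Linked Decr l

IsFCCanon : ℕ → ℕ → List (ℕ × ℕ) → Set
IsFCCanon n p l = IsCanon n p l × IsFC n (word l)

Thick : List (ℕ × ℕ) → Set
Thick l = All (λ s → proj₁ s < proj₂ s) l

IsThickCanon : ℕ → ℕ → List (ℕ × ℕ) → Set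
IsThickCanon n p l = (1 ≤ p) × IsFCCanon n p l × Thick l

bar : List (ℕ × ℕ) → List (ℕ × ℕ)
bar = map (λ s → (proj₁ s , proj₂ s ∸ 1))

{-# OPTIONS --safe #-}
-- W(A_n) acts on {0, …, n + 1} with σ_a the transposition (a a+1), and a word of length k gives a
-- permutation with at most k inversions, since each letter changes the inversion number by ±1. Removing
-- the first letter σ_i of a canonical word leaves a canonical word on which σ_i is an ascent, so
-- canonical words have exactly as many inversions as letters and are reduced. If σ_b v is another
-- reduced expression, σ_b is a left descent; in a canonical word a left descent is the first letter of
-- a segment all of whose predecessors commute with it, so it moves to the front by commutations and
-- induction on the length shows full commutativity. For thick canonical lists, w ↦ w̄ deletes the last
-- letter of each of the p segments, which is inverted by lengthening every segment of a canonical list.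
module Submission where

open import Defs
open import Data.Nat.Base
  using (ℕ; zero; suc; _+_; _*_; _∸_; _≤_; _<_; z≤n; s≤s; s≤s⁻¹; z<s; _<ᵇ_; _≡ᵇ_)
open import Data.Nat.Properties
open import Data.Nat.Tactic.RingSolver using (solve-∀)
open import Algebra.Properties.CommutativeSemigroup +-commutativeSemigroup using (interchange)
open import Data.Bool.Base using (Bool; true; false; _∧_; if_then_else_)
open import Data.Bool.Properties using (∧-zeroʳ)
open import Data.Sum.Base using (inj₁; inj₂)
open import Data.Product.Base using (_×_; _,_; proj₁; proj₂; Σ)
open import Data.List.Base using (List; []; _∷_; _++_; length; map; applyUpTo; head)
open import Data.List.Properties
  using (length-++; length-map; length-applyUpTo; ++-assoc; map-∘; map-id; map-id-local)
open import Data.List.Relation.Unary.All as All using (All; []; _∷_)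
open import Data.List.Relation.Unary.All.Properties using (++⁺) renaming (map⁺ to All-map⁺)
open import Data.List.Relation.Unary.Linked as Linked using (Linked; []; [-]; _∷_; head′; _∷′_)
open import Data.List.Relation.Unary.Linked.Properties using (Linked⇒All) renaming (map⁺ to Linked-map⁺)
open import Data.Maybe.Base using (just)
open import Data.Maybe.Relation.Binary.Connected using (Connected; just; just-nothing)
open import Function.Base using (_∘_)
open import Relation.Nullary.Decidable using (yes; no; dec-true; dec-false)
open import Relation.Nullary.Negation using (contradiction)
open import Relation.Binary.Definitions using (tri<; tri≈; tri>)
import Relation.Binary.PropositionalEquality as ≡
open ≡ using (_≡_; _≢_; refl; cong; cong₂; subst; subst₂; module ≡-Reasoning)

-- The permutation representation

swap : ℕ → ℕ → ℕ
swap zero    zero          = 1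
swap zero    (suc zero)    = 0
swap zero    (suc (suc x)) = suc (suc x)
swap (suc a) zero          = zero
swap (suc a) (suc x)       = suc (swap a x)

swap-involutive : ∀ a x → swap a (swap a x) ≡ x
swap-involutive zero    zero          = refl
swap-involutive zero    (suc zero)    = refl
swap-involutive zero    (suc (suc x)) = refl
swap-involutive (suc a) zero          = refl
swap-involutive (suc a) (suc x)       = cong suc (swap-involutive a x)

swap-commute : ∀ a b x → suc a < b → swap a (swap b x) ≡ swap b (swap a x)
swap-commute zero    (suc (suc b)) zero          _         = refl
swap-commute zero    (suc (suc b)) (suc zero)    _         = refl
swap-commute zero    (suc (suc b)) (suc (suc x)) _         = refl
swap-commute zero    (suc zero)    _             (s≤s ())
swap-commute (suc a) (suc b)       zero          _         = refl
swap-commute (suc a) (suc b)       (suc x)       (s≤s a<b) = cong suc (swap-commute a b x a<b)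

swap-braid : ∀ a x → swap a (swap (suc a) (swap a x)) ≡ swap (suc a) (swap a (swap (suc a) x))
swap-braid zero    zero                = refl
swap-braid zero    (suc zero)          = refl
swap-braid zero    (suc (suc zero))    = refl
swap-braid zero    (suc (suc (suc x))) = refl
swap-braid (suc a) zero                = refl
swap-braid (suc a) (suc x)             = cong suc (swap-braid a x)

swap-left : ∀ a → swap a a ≡ suc a
swap-left zero    = refl
swap-left (suc a) = cong suc (swap-left a)

swap-right : ∀ a → swap a (suc a) ≡ a
swap-right zero    = refl
swap-right (suc a) = cong suc (swap-right a)

swap-below : ∀ a x → x < a → swap a x ≡ x
swap-below (suc a) zero    _         = refl
swap-below (suc a) (suc x) (s≤s x<a) = cong suc (swap-below a x x<a)

swap-above : ∀ a x → suc a < x → swap a x ≡ x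
swap-above zero    (suc zero)    (s≤s ())
swap-above zero    (suc (suc x)) _         = refl
swap-above (suc a) (suc x)       (s≤s a<x) = cong suc (swap-above a x a<x)

swap-< : ∀ a x y → x < y → suc a < y → swap a x < y
swap-< zero    zero          y       _         a<y       = a<y
swap-< zero    (suc zero)    y       _         a<y       = <-trans z<s a<y
swap-< zero    (suc (suc x)) y       x<y       _         = x<y
swap-< (suc a) zero          (suc y) _         _         = z<s
swap-< (suc a) (suc x)       (suc y) (s≤s x<y) (s≤s a<y) = s≤s (swap-< a x y x<y a<y)

perm : List ℕ → ℕ → ℕ
perm []      x = x
perm (a ∷ u) x = swap a (perm u x)

perm⁻¹ : List ℕ → ℕ → ℕ
perm⁻¹ []      x = x
perm⁻¹ (a ∷ u) x = perm⁻¹ u (swap a x)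

perm-perm⁻¹ : ∀ u x → perm u (perm⁻¹ u x) ≡ x
perm-perm⁻¹ []      x = refl
perm-perm⁻¹ (a ∷ u) x = ≡.trans (cong (swap a) (perm-perm⁻¹ u (swap a x))) (swap-involutive a x)

perm⁻¹-perm : ∀ u x → perm⁻¹ u (perm u x) ≡ x
perm⁻¹-perm []      x = refl
perm⁻¹-perm (a ∷ u) x = ≡.trans (cong (perm⁻¹ u) (swap-involutive a (perm u x))) (perm⁻¹-perm u x)

perm-++ : ∀ u v x → perm (u ++ v) x ≡ perm u (perm v x)
perm-++ []      v x = refl
perm-++ (a ∷ u) v x = cong (swap a) (perm-++ u v x)

perm⁻¹-++ : ∀ u v x → perm⁻¹ (u ++ v) x ≡ perm⁻¹ v (perm⁻¹ u x)
perm⁻¹-++ []      v x = refl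
perm⁻¹-++ (a ∷ u) v x = perm⁻¹-++ u v (swap a x)

perm⁻¹-< : ∀ {n} u {x} → ValidWord n u → x < 2 + n → perm⁻¹ u x < 2 + n
perm⁻¹-< []      []                    x<n+2 = x<n+2
perm⁻¹-< (a ∷ u) ((_ , a≤n) ∷ valid) x<n+2 =
  perm⁻¹-< u valid (swap-< a _ _ x<n+2 (s≤s (s≤s a≤n)))

module _ {R : List ℕ → List ℕ → Set} where

  Congr-invariant : ∀ {B : Set} (F : List ℕ → B) →
                    (∀ x y {u v} → R u v → F (x ++ u ++ y) ≡ F (x ++ v ++ y)) →
                    ∀ {u v} → Congr R u v → F u ≡ F v
  Congr-invariant F inContext (step x u v y r) = inContext x y r
  Congr-invariant F inContext (refl u)         = refl
  Congr-invariant F inContext (sym c)          = ≡.sym (Congr-invariant F inContext c)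
  Congr-invariant F inContext (trans c d)      =
    ≡.trans (Congr-invariant F inContext c) (Congr-invariant F inContext d)

  Congr-++ˡ : ∀ w {u v} → Congr R u v → Congr R (w ++ u) (w ++ v)
  Congr-++ˡ w (step x u v y r) =
    subst₂ (Congr R) (++-assoc w x (u ++ y)) (++-assoc w x (v ++ y)) (step (w ++ x) u v y r)
  Congr-++ˡ w (refl u)    = refl (w ++ u)
  Congr-++ˡ w (sym c)     = sym (Congr-++ˡ w c)
  Congr-++ˡ w (trans c d) = trans (Congr-++ˡ w c) (Congr-++ˡ w d)

  ≡⇒Congr : ∀ {u v} → u ≡ v → Congr R u v
  ≡⇒Congr {u} refl = refl u

Congr-map : ∀ {R S : List ℕ → List ℕ → Set} → (∀ {u v} → R u v → S u v) →
            ∀ {u v} → Congr R u v → Congr S u v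
Congr-map f (step x u v y r) = step x u v y (f r)
Congr-map f (refl u)         = refl u
Congr-map f (sym c)          = sym (Congr-map f c)
Congr-map f (trans c d)      = trans (Congr-map f c) (Congr-map f d)

≈comm⇒≈ : ∀ {n u v} → u ≈comm⟨ n ⟩ v → u ≈⟨ n ⟩ v
≈comm⇒≈ = Congr-map λ { (comm a b a-gen b-gen a+1<b) → comm a b a-gen b-gen a+1<b }

≈comm-length : ∀ {n u v} → u ≈comm⟨ n ⟩ v → length u ≡ length v
≈comm-length = Congr-invariant length λ { x y (comm _ _ _ _ _) →
  ≡.trans (length-++ x) (≡.sym (length-++ x)) }

≈-cancelˡ : ∀ {n b u v} → Gen n b → (b ∷ u) ≈⟨ n ⟩ (b ∷ v) → u ≈⟨ n ⟩ v
≈-cancelˡ {b = b} {u} {v} b-gen b∷u≈b∷v =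
  trans (sym (step [] (b ∷ b ∷ []) [] u (quad b b-gen)))
        (trans (Congr-++ˡ (b ∷ []) b∷u≈b∷v) (step [] (b ∷ b ∷ []) [] v (quad b b-gen)))

perm-respects-≈ : ∀ {n u v} → u ≈⟨ n ⟩ v → ∀ z → perm u z ≡ perm v z
perm-respects-≈ {n} u≈v z = Congr-invariant (λ w → perm w z) inContext u≈v
  where
  relation : ∀ {u v} → CoxRel n u v → ∀ x → perm u x ≡ perm v x
  relation (quad a _)             = swap-involutive a
  relation (comm a b _ _ a+1<b) x = swap-commute a b x a+1<b
  relation (braid a _ _)          = swap-braid a

  inContext : ∀ x y {u v} → CoxRel n u v → perm (x ++ u ++ y) z ≡ perm (x ++ v ++ y) z
  inContext x y {u} {v} r = begin
    perm (x ++ u ++ y) z       ≡⟨ perm-++ x (u ++ y) z ⟩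
    perm x (perm (u ++ y) z)   ≡⟨ cong (perm x) (perm-++ u y z) ⟩
    perm x (perm u (perm y z)) ≡⟨ cong (perm x) (relation r (perm y z)) ⟩
    perm x (perm v (perm y z)) ≡⟨ cong (perm x) (perm-++ v y z) ⟨
    perm x (perm (v ++ y) z)   ≡⟨ perm-++ x (v ++ y) z ⟨
    perm (x ++ v ++ y) z       ∎
    where open ≡-Reasoning

perm⁻¹-respects-≈ : ∀ {n u v} → u ≈⟨ n ⟩ v → ∀ z → perm⁻¹ u z ≡ perm⁻¹ v z
perm⁻¹-respects-≈ {u = u} {v} u≈v z = begin
  perm⁻¹ u z                       ≡⟨ cong (perm⁻¹ u) (perm-perm⁻¹ v z) ⟨
  perm⁻¹ u (perm v (perm⁻¹ v z))   ≡⟨ cong (perm⁻¹ u) (perm-respects-≈ u≈v (perm⁻¹ v z)) ⟨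
  perm⁻¹ u (perm u (perm⁻¹ v z))   ≡⟨ perm⁻¹-perm u (perm⁻¹ v z) ⟩
  perm⁻¹ v z                       ∎
  where open ≡-Reasoning

-- Inversions

𝟙 : Bool → ℕ
𝟙 true  = 1
𝟙 false = 0

𝟙≤1 : ∀ b → 𝟙 b ≤ 1
𝟙≤1 true  = ≤-refl
𝟙≤1 false = z≤n

sumBelow : ℕ → (ℕ → ℕ) → ℕ
sumBelow zero    f = 0
sumBelow (suc M) f = sumBelow M f + f M

sumBelow-cong : ∀ M {f g} → (∀ x → f x ≡ g x) → sumBelow M f ≡ sumBelow M g
sumBelow-cong zero    f≗g = refl
sumBelow-cong (suc M) f≗g = cong₂ _+_ (sumBelow-cong M f≗g) (f≗g M)

sumBelow-+ : ∀ M f g → sumBelow M (λ x → f x + g x) ≡ sumBelow M f + sumBelow M g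
sumBelow-+ zero    f g = refl
sumBelow-+ (suc M) f g = ≡.trans (cong (_+ (f M + g M)) (sumBelow-+ M f g))
                                 (interchange (sumBelow M f) (sumBelow M g) (f M) (g M))

sumBelow-vanish : ∀ M f → (∀ y → y < M → f y ≡ 0) → sumBelow M f ≡ 0
sumBelow-vanish zero    f vanish = refl
sumBelow-vanish (suc M) f vanish =
  cong₂ _+_ (sumBelow-vanish M f (λ y y<M → vanish y (m<n⇒m<1+n y<M))) (vanish M ≤-refl)

sumBelow-point : ∀ M f {v} → v < M → (∀ y → y ≢ v → f y ≡ 0) → sumBelow M f ≡ f v
sumBelow-point (suc M) f v<1+M vanish with m≤n⇒m<n∨m≡n (s≤s⁻¹ v<1+M)
... | inj₁ v<M  = ≡.trans (cong₂ _+_ (sumBelow-point M f v<M vanish) (vanish M (>⇒≢ v<M)))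
                          (+-identityʳ _)
... | inj₂ refl = cong (_+ f M) (sumBelow-vanish M f (λ y y<M → vanish y (<⇒≢ y<M)))

sumBelow² : ℕ → (ℕ → ℕ → ℕ) → ℕ
sumBelow² M F = sumBelow M (λ x → sumBelow M (F x))

sumBelow²-cong : ∀ M {F G} → (∀ x y → F x y ≡ G x y) → sumBelow² M F ≡ sumBelow² M G
sumBelow²-cong M F≗G = sumBelow-cong M (λ x → sumBelow-cong M (F≗G x))

sumBelow²-+ : ∀ M F G → sumBelow² M (λ x y → F x y + G x y) ≡ sumBelow² M F + sumBelow² M G
sumBelow²-+ M F G = ≡.trans (sumBelow-cong M (λ x → sumBelow-+ M (F x) (G x)))
                            (sumBelow-+ M (λ x → sumBelow M (F x)) (λ x → sumBelow M (G x)))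

inversions : ℕ → (ℕ → ℕ) → ℕ
inversions M f = sumBelow² M (λ x y → 𝟙 (x <ᵇ y) * 𝟙 (f y <ᵇ f x))

inversions-cong : ∀ M {f g} → (∀ x → f x ≡ g x) → inversions M f ≡ inversions M g
inversions-cong M f≗g =
  sumBelow²-cong M λ x y → cong₂ (λ p q → 𝟙 (x <ᵇ y) * 𝟙 (q <ᵇ p)) (f≗g x) (f≗g y)

inversions-id : ∀ M → inversions M (λ x → x) ≡ 0
inversions-id M = sumBelow-vanish M _ λ x _ → sumBelow-vanish M _ λ y _ → 𝟙<ᵇ-asym x y
  where
  𝟙<ᵇ-asym : ∀ x y → 𝟙 (x <ᵇ y) * 𝟙 (y <ᵇ x) ≡ 0
  𝟙<ᵇ-asym zero    zero    = refl
  𝟙<ᵇ-asym zero    (suc y) = refl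
  𝟙<ᵇ-asym (suc x) zero    = refl
  𝟙<ᵇ-asym (suc x) (suc y) = 𝟙<ᵇ-asym x y

-- Swapping the values a and suc a reverses the order of a pair exactly when its values are {a, suc a}.
swap-inversion : ∀ a p q → 𝟙 (swap a q <ᵇ swap a p) + 𝟙 ((p ≡ᵇ suc a) ∧ (q ≡ᵇ a))
                         ≡ 𝟙 (q <ᵇ p) + 𝟙 ((p ≡ᵇ a) ∧ (q ≡ᵇ suc a))
swap-inversion zero    zero                zero          = refl
swap-inversion zero    zero                (suc zero)    = refl
swap-inversion zero    zero                (suc (suc q)) = refl
swap-inversion zero    (suc zero)          zero          = refl
swap-inversion zero    (suc zero)          (suc zero)    = refl
swap-inversion zero    (suc zero)          (suc (suc q)) = refl
swap-inversion zero    (suc (suc p))       zero          = refl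
swap-inversion zero    (suc (suc p))       (suc zero)    = refl
swap-inversion zero    (suc (suc p))       (suc (suc q)) = refl
swap-inversion (suc a) zero                zero          = refl
swap-inversion (suc a) zero                (suc q)       = refl
swap-inversion (suc a) (suc p)             zero
  rewrite ∧-zeroʳ (p ≡ᵇ suc a) | ∧-zeroʳ (p ≡ᵇ a) = refl
swap-inversion (suc a) (suc p)             (suc q)       = swap-inversion a p q

module _ {f g : ℕ → ℕ} (g∘f : ∀ x → g (f x) ≡ x) (f∘g : ∀ x → f (g x) ≡ x) where

  orderedPairs : ℕ → ℕ → ℕ → ℕ → ℕ
  orderedPairs a b x y = 𝟙 (x <ᵇ y) * 𝟙 ((f x ≡ᵇ a) ∧ (f y ≡ᵇ b))

  orderedPairs-count : ∀ M a b → g a < M → g b < M →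
                       sumBelow² M (orderedPairs a b) ≡ 𝟙 (g a <ᵇ g b)
  orderedPairs-count M a b ga<M gb<M = begin
    sumBelow² M (orderedPairs a b)
      ≡⟨ sumBelow-cong M (λ x → sumBelow-point M (orderedPairs a b x) gb<M (vanishʳ x)) ⟩
    sumBelow M (λ x → orderedPairs a b x (g b))
      ≡⟨ sumBelow-point M (λ x → orderedPairs a b x (g b)) ga<M vanishˡ ⟩
    orderedPairs a b (g a) (g b)
      ≡⟨ value ⟩
    𝟙 (g a <ᵇ g b) ∎
    where
    open ≡-Reasoning
    ≢-preimage : ∀ {y c} → y ≢ g c → (f y ≡ᵇ c) ≡ false
    ≢-preimage {y} {c} y≢gc = dec-false (f y ≟ c) λ fy≡c → y≢gc (≡.trans (≡.sym (g∘f y)) (cong g fy≡c))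

    vanishʳ : ∀ x y → y ≢ g b → orderedPairs a b x y ≡ 0
    vanishʳ x y y≢gb rewrite ≢-preimage y≢gb | ∧-zeroʳ (f x ≡ᵇ a) = *-zeroʳ (𝟙 (x <ᵇ y))

    vanishˡ : ∀ x → x ≢ g a → orderedPairs a b x (g b) ≡ 0
    vanishˡ x x≢ga rewrite ≢-preimage x≢ga = *-zeroʳ (𝟙 (x <ᵇ g b))

    value : orderedPairs a b (g a) (g b) ≡ 𝟙 (g a <ᵇ g b)
    value rewrite dec-true (f (g a) ≟ a) (f∘g a) | dec-true (f (g b) ≟ b) (f∘g b) = *-identityʳ _

  inversions-swap : ∀ M a → g a < M → g (suc a) < M →
                    inversions M (swap a ∘ f) + 𝟙 (g (suc a) <ᵇ g a)
                    ≡ inversions M f + 𝟙 (g a <ᵇ g (suc a))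
  inversions-swap M a ga<M gsa<M = begin
    inversions M (swap a ∘ f) + 𝟙 (g (suc a) <ᵇ g a)
      ≡⟨ cong (inversions M (swap a ∘ f) +_) (orderedPairs-count M (suc a) a gsa<M ga<M) ⟨
    inversions M (swap a ∘ f) + sumBelow² M (orderedPairs (suc a) a)
      ≡⟨ sumBelow²-+ M _ _ ⟨
    sumBelow² M (λ x y → 𝟙 (x <ᵇ y) * 𝟙 (swap a (f y) <ᵇ swap a (f x)) + orderedPairs (suc a) a x y)
      ≡⟨ sumBelow²-cong M pointwise ⟩
    sumBelow² M (λ x y → 𝟙 (x <ᵇ y) * 𝟙 (f y <ᵇ f x) + orderedPairs a (suc a) x y)
      ≡⟨ sumBelow²-+ M _ _ ⟩
    inversions M f + sumBelow² M (orderedPairs a (suc a))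
      ≡⟨ cong (inversions M f +_) (orderedPairs-count M a (suc a) ga<M gsa<M) ⟩
    inversions M f + 𝟙 (g a <ᵇ g (suc a)) ∎
    where
    open ≡-Reasoning
    pointwise : ∀ x y → 𝟙 (x <ᵇ y) * 𝟙 (swap a (f y) <ᵇ swap a (f x)) + orderedPairs (suc a) a x y
                      ≡ 𝟙 (x <ᵇ y) * 𝟙 (f y <ᵇ f x) + orderedPairs a (suc a) x y
    pointwise x y = begin
      𝟙 (x <ᵇ y) * 𝟙 (swap a (f y) <ᵇ swap a (f x)) + 𝟙 (x <ᵇ y) * 𝟙 ((f x ≡ᵇ suc a) ∧ (f y ≡ᵇ a))
        ≡⟨ *-distribˡ-+ (𝟙 (x <ᵇ y)) _ _ ⟨
      𝟙 (x <ᵇ y) * (𝟙 (swap a (f y) <ᵇ swap a (f x)) + 𝟙 ((f x ≡ᵇ suc a) ∧ (f y ≡ᵇ a)))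
        ≡⟨ cong (𝟙 (x <ᵇ y) *_) (swap-inversion a (f x) (f y)) ⟩
      𝟙 (x <ᵇ y) * (𝟙 (f y <ᵇ f x) + 𝟙 ((f x ≡ᵇ a) ∧ (f y ≡ᵇ suc a)))
        ≡⟨ *-distribˡ-+ (𝟙 (x <ᵇ y)) _ _ ⟩
      𝟙 (x <ᵇ y) * 𝟙 (f y <ᵇ f x) + 𝟙 (x <ᵇ y) * 𝟙 ((f x ≡ᵇ a) ∧ (f y ≡ᵇ suc a)) ∎

-- σ_1, …, σ_n permute {0, …, n + 1}, so inversions of words of W(A_n) are counted below 2 + n.
inversions-perm-∷ : ∀ {n a} v → Gen n a → ValidWord n v →
                    inversions (2 + n) (perm (a ∷ v)) + 𝟙 (perm⁻¹ v (suc a) <ᵇ perm⁻¹ v a)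
                    ≡ inversions (2 + n) (perm v) + 𝟙 (perm⁻¹ v a <ᵇ perm⁻¹ v (suc a))
inversions-perm-∷ {n} {a} v (_ , a≤n) valid =
  inversions-swap (perm⁻¹-perm v) (perm-perm⁻¹ v) (2 + n) a
    (perm⁻¹-< v valid (s≤s (m≤n⇒m≤1+n a≤n))) (perm⁻¹-< v valid (s≤s (s≤s a≤n)))

inversions-perm-≤-length : ∀ {n} v → ValidWord n v → inversions (2 + n) (perm v) ≤ length v
inversions-perm-≤-length {n} []      []               = ≤-reflexive (inversions-id (2 + n))
inversions-perm-≤-length {n} (a ∷ v) (a-gen ∷ valid) = begin
  inversions (2 + n) (perm (a ∷ v))
    ≤⟨ m≤m+n _ _ ⟩
  inversions (2 + n) (perm (a ∷ v)) + 𝟙 (perm⁻¹ v (suc a) <ᵇ perm⁻¹ v a)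
    ≡⟨ inversions-perm-∷ v a-gen valid ⟩
  inversions (2 + n) (perm v) + 𝟙 (perm⁻¹ v a <ᵇ perm⁻¹ v (suc a))
    ≤⟨ +-mono-≤ (inversions-perm-≤-length v valid) (𝟙≤1 _) ⟩
  length v + 1
    ≡⟨ +-comm (length v) 1 ⟩
  length (a ∷ v) ∎
  where open ≤-Reasoning

inversions-perm-∷-ascent : ∀ {n a} v → Gen n a → ValidWord n v → perm⁻¹ v a < perm⁻¹ v (suc a) →
                           inversions (2 + n) (perm (a ∷ v)) ≡ suc (inversions (2 + n) (perm v))
inversions-perm-∷-ascent {n} {a} v a-gen valid ascent = begin
  inversions (2 + n) (perm (a ∷ v))
    ≡⟨ +-identityʳ _ ⟨
  inversions (2 + n) (perm (a ∷ v)) + 𝟙 false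
    ≡⟨ cong (λ b → inversions (2 + n) (perm (a ∷ v)) + 𝟙 b) (dec-false (_ <? _) (<⇒≯ ascent)) ⟨
  inversions (2 + n) (perm (a ∷ v)) + 𝟙 (perm⁻¹ v (suc a) <ᵇ perm⁻¹ v a)
    ≡⟨ inversions-perm-∷ v a-gen valid ⟩
  inversions (2 + n) (perm v) + 𝟙 (perm⁻¹ v a <ᵇ perm⁻¹ v (suc a))
    ≡⟨ cong (λ b → inversions (2 + n) (perm v) + 𝟙 b) (dec-true (_ <? _) ascent) ⟩
  inversions (2 + n) (perm v) + 1
    ≡⟨ +-comm _ 1 ⟩
  suc (inversions (2 + n) (perm v)) ∎
  where open ≡-Reasoning

length<inversions⇒ascent : ∀ {n a} v → Gen n a → ValidWord n v →
                           length v < inversions (2 + n) (perm (a ∷ v)) → perm⁻¹ v a < perm⁻¹ v (suc a)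
length<inversions⇒ascent {n} {a} v a-gen valid long with perm⁻¹ v a <? perm⁻¹ v (suc a)
... | yes ascent = ascent
... | no ¬ascent = contradiction long (≤⇒≯ (begin
  inversions (2 + n) (perm (a ∷ v))
    ≤⟨ m≤m+n _ _ ⟩
  inversions (2 + n) (perm (a ∷ v)) + 𝟙 (perm⁻¹ v (suc a) <ᵇ perm⁻¹ v a)
    ≡⟨ inversions-perm-∷ v a-gen valid ⟩
  inversions (2 + n) (perm v) + 𝟙 (perm⁻¹ v a <ᵇ perm⁻¹ v (suc a))
    ≡⟨ cong (λ b → inversions (2 + n) (perm v) + 𝟙 b) (dec-false (_ <? _) ¬ascent) ⟩
  inversions (2 + n) (perm v) + 0
    ≡⟨ +-identityʳ _ ⟩
  inversions (2 + n) (perm v)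
    ≤⟨ inversions-perm-≤-length v valid ⟩
  length v ∎))
  where open ≤-Reasoning

-- Segments

run : ℕ → ℕ → List ℕ
run i zero    = []
run i (suc d) = i ∷ run (suc i) d

map-applyUpTo-run : ∀ (h f : ℕ → ℕ) i d → (∀ k → h (f k) ≡ i + k) → map h (applyUpTo f d) ≡ run i d
map-applyUpTo-run h f i zero    hf≗i+ = refl
map-applyUpTo-run h f i (suc d) hf≗i+ =
  cong₂ _∷_ (≡.trans (hf≗i+ 0) (+-identityʳ i))
            (map-applyUpTo-run h (f ∘ suc) (suc i) d (λ k → ≡.trans (hf≗i+ (suc k)) (+-suc i k)))

seg≡run : ∀ i j → seg (i , j) ≡ run i (suc (j ∸ i))
seg≡run i j = map-applyUpTo-run (i +_) (λ k → k) i (suc (j ∸ i)) (λ _ → refl)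

run-end : ∀ {i j} → i ≤ j → i + suc (j ∸ i) ≡ suc j
run-end {i} {j} i≤j = ≡.trans (+-suc i (j ∸ i)) (cong suc (m+[n∸m]≡n i≤j))

run-letters : ∀ i d → All (λ c → i ≤ c × c < i + d) (run i d)
run-letters i zero    = []
run-letters i (suc d) =
  (≤-refl , ≤-trans (s≤s (m≤m+n i d)) (≤-reflexive (≡.sym (+-suc i d))))
  ∷ All.map widen (run-letters (suc i) d)
  where
  widen : ∀ {c} → suc i ≤ c × c < suc i + d → i ≤ c × c < i + suc d
  widen {c} (i<c , c<end) = <⇒≤ i<c , subst (c <_) (≡.sym (+-suc i d)) c<end

perm⁻¹-run-below : ∀ i d {c} → c < i → perm⁻¹ (run i d) c ≡ c
perm⁻¹-run-below i zero    c<i = refl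
perm⁻¹-run-below i (suc d) c<i =
  ≡.trans (cong (perm⁻¹ (run (suc i) d)) (swap-below i _ c<i)) (perm⁻¹-run-below (suc i) d (m<n⇒m<1+n c<i))

perm⁻¹-run-above : ∀ i d {c} → i + d < c → perm⁻¹ (run i d) c ≡ c
perm⁻¹-run-above i zero    end<c = refl
perm⁻¹-run-above i (suc d) {c} end<c =
  ≡.trans (cong (perm⁻¹ (run (suc i) d)) (swap-above i c (≤-<-trans (s≤s (m≤m+n i d)) end<c')))
          (perm⁻¹-run-above (suc i) d end<c')
  where
  end<c' : suc i + d < c
  end<c' = subst (_< c) (+-suc i d) end<c

perm⁻¹-run-first : ∀ i d → perm⁻¹ (run i d) i ≡ i + d
perm⁻¹-run-first i zero    = ≡.sym (+-identityʳ i)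
perm⁻¹-run-first i (suc d) = begin
  perm⁻¹ (run (suc i) d) (swap i i) ≡⟨ cong (perm⁻¹ (run (suc i) d)) (swap-left i) ⟩
  perm⁻¹ (run (suc i) d) (suc i)    ≡⟨ perm⁻¹-run-first (suc i) d ⟩
  suc i + d                         ≡⟨ +-suc i d ⟨
  i + suc d                         ∎
  where open ≡-Reasoning

perm⁻¹-run-shift : ∀ i d {c} → i ≤ c → c < i + d → perm⁻¹ (run i d) (suc c) ≡ c
perm⁻¹-run-shift i zero    i≤c c<i+0 = contradiction (subst (_ <_) (+-identityʳ i) c<i+0) (≤⇒≯ i≤c)
perm⁻¹-run-shift i (suc d) {c} i≤c c<end with m≤n⇒m<n∨m≡n i≤c
... | inj₂ refl = ≡.trans (cong (perm⁻¹ (run (suc i) d)) (swap-right i)) (perm⁻¹-run-below (suc i) d ≤-refl)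
... | inj₁ i<c  = ≡.trans (cong (perm⁻¹ (run (suc i) d)) (swap-above i (suc c) (s≤s i<c)))
                          (perm⁻¹-run-shift (suc i) d i<c (subst (c <_) (+-suc i d) c<end))

perm⁻¹-run-< : ∀ i d {x y} → x < y → i + d < y → perm⁻¹ (run i d) x < y
perm⁻¹-run-< i zero    x<y _     = x<y
perm⁻¹-run-< i (suc d) {x} {y} x<y end<y =
  perm⁻¹-run-< (suc i) d (swap-< i x y x<y (≤-<-trans (s≤s (m≤m+n i d)) end<y')) end<y'
  where
  end<y' : suc i + d < y
  end<y' = subst (_< y) (+-suc i d) end<y

seg-step : ∀ {i j} → i < j → seg (i , j) ≡ i ∷ seg (suc i , j)
seg-step {i} {j} i<j = begin
  seg (i , j)                       ≡⟨ seg≡run i j ⟩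
  run i (suc (j ∸ i))               ≡⟨ cong (λ d → run i (suc d)) (+-∸-assoc 1 i<j) ⟩
  i ∷ run (suc i) (suc (j ∸ suc i)) ≡⟨ cong (i ∷_) (seg≡run (suc i) j) ⟨
  i ∷ seg (suc i , j)               ∎
  where open ≡-Reasoning

seg-single : ∀ i → seg (i , i) ≡ i ∷ []
seg-single i = ≡.trans (seg≡run i i) (cong (λ d → run i (suc d)) (n∸n≡0 i))

seg-letters : ∀ {n i j} → SegOK n (i , j) → All (λ c → i ≤ c × Gen n c) (seg (i , j))
seg-letters {n} {i} {j} (1≤i , i≤j , j≤n) =
  subst (All _) (≡.sym (seg≡run i j)) (All.map letter (run-letters i (suc (j ∸ i))))
  where
  letter : ∀ {c} → i ≤ c × c < i + suc (j ∸ i) → i ≤ c × Gen n c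
  letter (i≤c , c<end) =
    i≤c , ≤-trans 1≤i i≤c , ≤-trans (s≤s⁻¹ (≤-trans c<end (≤-reflexive (run-end i≤j)))) j≤n

perm⁻¹-seg-below : ∀ {i j c} → c < i → perm⁻¹ (seg (i , j)) c ≡ c
perm⁻¹-seg-below {i} {j} {c} c<i =
  subst (λ u → perm⁻¹ u c ≡ c) (≡.sym (seg≡run i j)) (perm⁻¹-run-below i (suc (j ∸ i)) c<i)

perm⁻¹-seg-above : ∀ {i j c} → i ≤ j → suc j < c → perm⁻¹ (seg (i , j)) c ≡ c
perm⁻¹-seg-above {i} {j} {c} i≤j j+1<c =
  subst (λ u → perm⁻¹ u c ≡ c) (≡.sym (seg≡run i j))
        (perm⁻¹-run-above i (suc (j ∸ i)) (subst (_< c) (≡.sym (run-end i≤j)) j+1<c))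

perm⁻¹-seg-first : ∀ {i j} → i ≤ j → perm⁻¹ (seg (i , j)) i ≡ suc j
perm⁻¹-seg-first {i} {j} i≤j =
  subst (λ u → perm⁻¹ u i ≡ suc j) (≡.sym (seg≡run i j))
        (≡.trans (perm⁻¹-run-first i (suc (j ∸ i))) (run-end i≤j))

perm⁻¹-seg-shift : ∀ {i j c} → i ≤ c → c ≤ j → perm⁻¹ (seg (i , j)) (suc c) ≡ c
perm⁻¹-seg-shift {i} {j} {c} i≤c c≤j =
  subst (λ u → perm⁻¹ u (suc c) ≡ c) (≡.sym (seg≡run i j))
        (perm⁻¹-run-shift i (suc (j ∸ i)) i≤c (subst (c <_) (≡.sym (run-end (≤-trans i≤c c≤j))) (s≤s c≤j)))

perm⁻¹-seg-< : ∀ {i j x y} → i ≤ j → x < y → suc j < y → perm⁻¹ (seg (i , j)) x < y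
perm⁻¹-seg-< {i} {j} {x} {y} i≤j x<y j+1<y =
  subst (λ u → perm⁻¹ u x < y) (≡.sym (seg≡run i j))
        (perm⁻¹-run-< i (suc (j ∸ i)) x<y (subst (_< y) (≡.sym (run-end i≤j)) j+1<y))

-- Canonical words

Canonical : ℕ → List (ℕ × ℕ) → Set
Canonical n l = All (SegOK n) l × Linked Decr l

word-valid : ∀ {n} l → All (SegOK n) l → ValidWord n (word l)
word-valid []      []         = []
word-valid (_ ∷ l) (ok ∷ oks) = ++⁺ (All.map proj₂ (seg-letters ok)) (word-valid l oks)

perm⁻¹-word-∷ : ∀ s rest x → perm⁻¹ (word (s ∷ rest)) x ≡ perm⁻¹ (word rest) (perm⁻¹ (seg s) x)
perm⁻¹-word-∷ s rest = perm⁻¹-++ (seg s) (word rest)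

EndsBelow : ℕ → List (ℕ × ℕ) → Set
EndsBelow y = All (λ s → suc (proj₂ s) < y)

perm⁻¹-word-fix : ∀ {n y} l → All (SegOK n) l → EndsBelow y l → perm⁻¹ (word l) y ≡ y
perm⁻¹-word-fix         []            []                   []             = refl
perm⁻¹-word-fix {y = y} ((i , j) ∷ l) ((_ , i≤j , _) ∷ oks) (j+1<y ∷ ends) = begin
  perm⁻¹ (word ((i , j) ∷ l)) y            ≡⟨ perm⁻¹-word-∷ (i , j) l y ⟩
  perm⁻¹ (word l) (perm⁻¹ (seg (i , j)) y) ≡⟨ cong (perm⁻¹ (word l)) (perm⁻¹-seg-above i≤j j+1<y) ⟩
  perm⁻¹ (word l) y                        ≡⟨ perm⁻¹-word-fix l oks ends ⟩
  y                                        ∎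
  where open ≡-Reasoning

perm⁻¹-word-< : ∀ {n x y} l → All (SegOK n) l → EndsBelow y l → x < y → perm⁻¹ (word l) x < y
perm⁻¹-word-<         []            []                   []             x<y = x<y
perm⁻¹-word-< {x = x} ((i , j) ∷ l) ((_ , i≤j , _) ∷ oks) (j+1<y ∷ ends) x<y =
  subst (_< _) (≡.sym (perm⁻¹-word-∷ (i , j) l x))
        (perm⁻¹-word-< l oks ends (perm⁻¹-seg-< i≤j x<y j+1<y))

perm⁻¹-word-ascent : ∀ {n x y} l → All (SegOK n) l → EndsBelow y l → x < y →
                     perm⁻¹ (word l) x < perm⁻¹ (word l) y
perm⁻¹-word-ascent l oks ends x<y =
  subst (_ <_) (≡.sym (perm⁻¹-word-fix l oks ends)) (perm⁻¹-word-< l oks ends x<y)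

Decr-trans : ∀ {x y z} → Decr x y → Decr y z → Decr x z
Decr-trans {_ , _} {_ , _} {_ , _} (i₂<i₁ , j₂<j₁) (i₃<i₂ , j₃<j₂) =
  <-trans i₃<i₂ i₂<i₁ , <-trans j₃<j₂ j₂<j₁

Linked-Decr⇒All : ∀ {x l} → Linked Decr (x ∷ l) → All (Decr x) l
Linked-Decr⇒All [-]           = []
Linked-Decr⇒All (x>y ∷ linked) = Linked⇒All Decr-trans x>y linked

endsBelow : ∀ {i j l y} → suc j ≤ y → Linked Decr ((i , j) ∷ l) → EndsBelow y l
endsBelow {i} {j} {y = y} j<y linked = All.map below (Linked-Decr⇒All linked)
  where
  below : ∀ {s} → Decr (i , j) s → suc (proj₂ s) < y
  below {_ , _} (_ , j'<j) = ≤-trans (s≤s j'<j) j<y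

Decr-head-trans : ∀ {x y m} → Decr x y → Connected Decr (just y) m → Connected Decr (just x) m
Decr-head-trans x>y (just y>z)   = just (Decr-trans x>y y>z)
Decr-head-trans _   just-nothing = just-nothing

Decr-head-suc : ∀ {i j m} → Connected Decr (just (i , j)) m → Connected Decr (just (suc i , j)) m
Decr-head-suc {m = just (_ , _)} (just (i'<i , j'<j)) = just (m<n⇒m<1+n i'<i , j'<j)
Decr-head-suc just-nothing = just-nothing

dropFirstLetter : ℕ × ℕ → List (ℕ × ℕ) → List (ℕ × ℕ)
dropFirstLetter (i , j) rest = if i <ᵇ j then (suc i , j) ∷ rest else rest

dropFirstLetter-< : ∀ {i j} rest → i < j → dropFirstLetter (i , j) rest ≡ (suc i , j) ∷ rest
dropFirstLetter-< {i} {j} rest i<j rewrite dec-true (i <? j) i<j = refl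

dropFirstLetter-≡ : ∀ {i} rest → dropFirstLetter (i , i) rest ≡ rest
dropFirstLetter-≡ {i} rest rewrite dec-false (i <? i) (<-irrefl refl) = refl

word-dropFirstLetter : ∀ {i j} rest → i ≤ j →
                       word ((i , j) ∷ rest) ≡ i ∷ word (dropFirstLetter (i , j) rest)
word-dropFirstLetter {i} rest i≤j with m≤n⇒m<n∨m≡n i≤j
... | inj₁ i<j  = ≡.trans (cong (_++ word rest) (seg-step i<j))
                         (cong (λ l → i ∷ word l) (≡.sym (dropFirstLetter-< rest i<j)))
... | inj₂ refl = ≡.trans (cong (_++ word rest) (seg-single i))
                         (cong (λ l → i ∷ word l) (≡.sym (dropFirstLetter-≡ {i} rest)))

dropFirstLetter-canonical : ∀ {n i j rest} → Canonical n ((i , j) ∷ rest) →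
                            Canonical n (dropFirstLetter (i , j) rest)
dropFirstLetter-canonical {rest = rest} ((_ , i≤j , j≤n) ∷ oks , linked) with m≤n⇒m<n∨m≡n i≤j
... | inj₁ i<j  = subst (Canonical _) (≡.sym (dropFirstLetter-< rest i<j))
                       ((s≤s z≤n , i<j , j≤n) ∷ oks , Decr-head-suc (head′ linked) ∷′ Linked.tail linked)
... | inj₂ refl = subst (Canonical _) (≡.sym (dropFirstLetter-≡ rest)) (oks , Linked.tail linked)

-- σ_b is the first letter of a segment and every earlier letter is ≥ b + 2, so σ_b commutes to the front.
data Movable : List (ℕ × ℕ) → ℕ → Set where
  here  : ∀ {i j rest} → Movable ((i , j) ∷ rest) i
  there : ∀ {i j rest b} → suc b < i → Movable rest b → Movable ((i , j) ∷ rest) b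

Movable-< : ∀ {i j rest b} → Linked Decr ((i , j) ∷ rest) → Movable rest b → b < i
Movable-< ((i'<i , _) ∷ _) here              = i'<i
Movable-< ((i'<i , _) ∷ _) (there b+1<i' _) = <-trans (<-trans (n<1+n _) b+1<i') i'<i

remove : ∀ l {b} → Movable l b → List (ℕ × ℕ)
remove ((i , j) ∷ rest) here        = dropFirstLetter (i , j) rest
remove (s ∷ rest)       (there _ m) = s ∷ remove rest m

remove-head : ∀ {n i j b} rest → All (SegOK n) rest → Linked Decr ((i , j) ∷ rest) → suc b < i →
              (m : Movable rest b) → Connected Decr (just (i , j)) (head (remove rest m))
remove-head {i = i} {j} ((i₂ , j₂) ∷ rest) ((_ , i₂≤j₂ , _) ∷ _) (x>y ∷ linked) b+1<i here
  with m≤n⇒m<n∨m≡n i₂≤j₂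
... | inj₁ i₂<j₂ = subst (λ l → Connected Decr (just (i , j)) (head l))
                         (≡.sym (dropFirstLetter-< rest i₂<j₂)) (just (b+1<i , proj₂ x>y))
... | inj₂ refl  = subst (λ l → Connected Decr (just (i , j)) (head l))
                         (≡.sym (dropFirstLetter-≡ rest)) (Decr-head-trans x>y (head′ linked))
remove-head (_ ∷ _) _ (x>y ∷ _) _ (there _ _) = just x>y

remove-canonical : ∀ {n b} l (m : Movable l b) → Canonical n l → Canonical n (remove l m)
remove-canonical (_ ∷ _)    here            canonical           = dropFirstLetter-canonical canonical
remove-canonical (_ ∷ rest) (there b+1<i m) (ok ∷ oks , linked) =
  ok ∷ oks′ , remove-head rest oks linked b+1<i m ∷′ linked′
  where
  canonical′ = remove-canonical rest m (oks , Linked.tail linked)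
  oks′       = proj₁ canonical′
  linked′    = proj₂ canonical′

commute-to-front : ∀ {n b} w z → All (λ c → suc b < c × Gen n c) w → Gen n b →
                   (w ++ b ∷ z) ≈comm⟨ n ⟩ (b ∷ w ++ z)
commute-to-front         []      z []                    b-gen = refl _
commute-to-front {b = b} (c ∷ w) z ((b+1<c , c-gen) ∷ far) b-gen =
  trans (Congr-++ˡ (c ∷ []) (commute-to-front w z far b-gen))
        (sym (step [] (b ∷ c ∷ []) (c ∷ b ∷ []) (w ++ z) (comm b c b-gen c-gen b+1<c)))

word≈comm-remove : ∀ {n b} l (m : Movable l b) → Canonical n l → Gen n b →
                   word l ≈comm⟨ n ⟩ (b ∷ word (remove l m))
word≈comm-remove ((i , j) ∷ rest) here ((_ , i≤j , _) ∷ _ , _) _ =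
  ≡⇒Congr (word-dropFirstLetter rest i≤j)
word≈comm-remove {n} {b} ((i , j) ∷ rest) (there b+1<i m) (ok ∷ oks , linked) b-gen =
  trans (Congr-++ˡ (seg (i , j)) (word≈comm-remove rest m (oks , Linked.tail linked) b-gen))
        (commute-to-front (seg (i , j)) _ (All.map far (seg-letters ok)) b-gen)
  where
  far : ∀ {c} → i ≤ c × Gen n c → suc b < c × Gen n c
  far (i≤c , c-gen) = <-≤-trans b+1<i i≤c , c-gen

-- σ_b is a left descent of u, i.e. ℓ(σ_b u) < ℓ(u).
Descent : List ℕ → ℕ → Set
Descent u b = perm⁻¹ u (suc b) < perm⁻¹ u b

Descent-respects-≈ : ∀ {n u v b} → u ≈⟨ n ⟩ v → Descent u b → Descent v b
Descent-respects-≈ u≈v = subst₂ _<_ (perm⁻¹-respects-≈ u≈v _) (perm⁻¹-respects-≈ u≈v _)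

Descent-word-∷ : ∀ s rest {b c d} → perm⁻¹ (seg s) (suc b) ≡ c → perm⁻¹ (seg s) b ≡ d →
                 Descent (word (s ∷ rest)) b → perm⁻¹ (word rest) c < perm⁻¹ (word rest) d
Descent-word-∷ s rest {b} refl refl =
  subst₂ _<_ (perm⁻¹-word-∷ s rest (suc b)) (perm⁻¹-word-∷ s rest b)

-- Below i the segment [i,j] fixes b and suc b, so the descent comes from rest; otherwise it turns
-- into a descent of rest at a letter ≥ i, which cannot be movable, or clashes with the ascent of rest
-- at the point suc j that rest leaves fixed.
Descent⇒Movable : ∀ {n} l b → Canonical n l → Descent (word l) b → Movable l b
Descent⇒Movable [] b _ desc = contradiction desc (<⇒≯ (n<1+n b))
Descent⇒Movable ((i , j) ∷ rest) b ((_ , i≤j , _) ∷ oks , linked) desc with <-cmp b i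
... | tri≈ _ refl _ = here
... | tri< b<i _ _ with m≤n⇒m<n∨m≡n b<i
...   | inj₁ b+1<i = there b+1<i (Descent⇒Movable rest b (oks , Linked.tail linked) desc′)
  where
  desc′ : Descent (word rest) b
  desc′ = Descent-word-∷ (i , j) rest (perm⁻¹-seg-below b+1<i) (perm⁻¹-seg-below b<i) desc
...   | inj₂ refl  = contradiction desc′ (<⇒≯ ascent)
  where
  desc′ : perm⁻¹ (word rest) (suc j) < perm⁻¹ (word rest) b
  desc′ = Descent-word-∷ (i , j) rest (perm⁻¹-seg-first i≤j) (perm⁻¹-seg-below {j = j} b<i) desc
  ascent : perm⁻¹ (word rest) b < perm⁻¹ (word rest) (suc j)
  ascent = perm⁻¹-word-ascent rest oks (endsBelow ≤-refl linked) (m≤n⇒m≤1+n i≤j)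
Descent⇒Movable ((i , j) ∷ rest) b ((_ , i≤j , _) ∷ oks , linked) desc
  | tri> _ _ (s≤s {n = c} i≤c) with <-cmp c j
... | tri< c<j _ _ =
  contradiction (Movable-< linked (Descent⇒Movable rest c (oks , Linked.tail linked) desc′)) (≤⇒≯ i≤c)
  where
  desc′ : Descent (word rest) c
  desc′ = Descent-word-∷ (i , j) rest (perm⁻¹-seg-shift (m≤n⇒m≤1+n i≤c) c<j)
                                      (perm⁻¹-seg-shift i≤c (<⇒≤ c<j)) desc
... | tri≈ _ refl _ = contradiction desc′ (<⇒≯ ascent)
  where
  desc′ : perm⁻¹ (word rest) (suc (suc c)) < perm⁻¹ (word rest) c
  desc′ = Descent-word-∷ (i , j) rest (perm⁻¹-seg-above i≤j ≤-refl) (perm⁻¹-seg-shift i≤c ≤-refl) desc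
  ascent : perm⁻¹ (word rest) c < perm⁻¹ (word rest) (suc (suc c))
  ascent = perm⁻¹-word-ascent rest oks (endsBelow (n≤1+n _) linked) (m<n⇒m<1+n (n<1+n c))
... | tri> _ _ j<c =
  contradiction (Movable-< linked (Descent⇒Movable rest (suc c) (oks , Linked.tail linked) desc′))
                (≤⇒≯ (m≤n⇒m≤1+n i≤c))
  where
  desc′ : Descent (word rest) (suc c)
  desc′ = Descent-word-∷ (i , j) rest (perm⁻¹-seg-above i≤j (s≤s (m≤n⇒m≤1+n j<c)))
                                      (perm⁻¹-seg-above i≤j (s≤s j<c)) desc

dropFirstLetter-ascent : ∀ {n i j rest} → Canonical n ((i , j) ∷ rest) →
                         let w = word (dropFirstLetter (i , j) rest) in perm⁻¹ w i < perm⁻¹ w (suc i)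
dropFirstLetter-ascent {i = i} {j} {rest} ((_ , i≤j , _) ∷ oks , linked) with m≤n⇒m<n∨m≡n i≤j
... | inj₁ i<j  = subst (λ l → perm⁻¹ (word l) i < perm⁻¹ (word l) (suc i))
                        (≡.sym (dropFirstLetter-< rest i<j)) (begin-strict
  perm⁻¹ (word ((suc i , j) ∷ rest)) i
    ≡⟨ perm⁻¹-word-∷ (suc i , j) rest i ⟩
  perm⁻¹ (word rest) (perm⁻¹ (seg (suc i , j)) i)
    ≡⟨ cong (perm⁻¹ (word rest)) (perm⁻¹-seg-below {j = j} ≤-refl) ⟩
  perm⁻¹ (word rest) i
    <⟨ perm⁻¹-word-ascent rest oks (endsBelow ≤-refl linked) (s≤s (<⇒≤ i<j)) ⟩
  perm⁻¹ (word rest) (suc j)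
    ≡⟨ cong (perm⁻¹ (word rest)) (perm⁻¹-seg-first i<j) ⟨
  perm⁻¹ (word rest) (perm⁻¹ (seg (suc i , j)) (suc i))
    ≡⟨ perm⁻¹-word-∷ (suc i , j) rest (suc i) ⟨
  perm⁻¹ (word ((suc i , j) ∷ rest)) (suc i) ∎)
  where open ≤-Reasoning
... | inj₂ refl = subst (λ l → perm⁻¹ (word l) i < perm⁻¹ (word l) (suc i))
                        (≡.sym (dropFirstLetter-≡ {i} rest))
                        (perm⁻¹-word-ascent rest oks (endsBelow ≤-refl linked) ≤-refl)

inversions-canonical : ∀ {n} l → Canonical n l → inversions (2 + n) (perm (word l)) ≡ length (word l)
inversions-canonical {n} l = bounded (length (word l)) l ≤-refl
  where
  bounded : ∀ k l → length (word l) ≤ k → Canonical n l →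
            inversions (2 + n) (perm (word l)) ≡ length (word l)
  bounded _       []               _      _ = inversions-id (2 + n)
  bounded (suc k) ((i , j) ∷ rest) len≤k canonical@(((1≤i , i≤j , j≤n) ∷ _) , _) = begin
    inversions (2 + n) (perm (word ((i , j) ∷ rest)))
      ≡⟨ cong (inversions (2 + n) ∘ perm) split ⟩
    inversions (2 + n) (perm (i ∷ word l′))
      ≡⟨ inversions-perm-∷-ascent (word l′) i-gen valid′ ascent ⟩
    suc (inversions (2 + n) (perm (word l′)))
      ≡⟨ cong suc (bounded k l′ len′≤k canonical′) ⟩
    suc (length (word l′))
      ≡⟨ cong length split ⟨
    length (word ((i , j) ∷ rest)) ∎
    where
    open ≡-Reasoning
    l′ : List (ℕ × ℕ)
    l′ = dropFirstLetter (i , j) rest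

    split : word ((i , j) ∷ rest) ≡ i ∷ word l′
    split = word-dropFirstLetter rest i≤j

    canonical′ : Canonical n l′
    canonical′ = dropFirstLetter-canonical canonical

    valid′ : ValidWord n (word l′)
    valid′ = word-valid l′ (proj₁ canonical′)

    ascent : perm⁻¹ (word l′) i < perm⁻¹ (word l′) (suc i)
    ascent = dropFirstLetter-ascent canonical

    i-gen : Gen n i
    i-gen = 1≤i , ≤-trans i≤j j≤n

    len′≤k : length (word l′) ≤ k
    len′≤k = s≤s⁻¹ (subst (_≤ suc k) (cong length split) len≤k)

canonical-length-minimal : ∀ {n l v} → Canonical n l → ValidWord n v → word l ≈⟨ n ⟩ v →
                           length (word l) ≤ length v
canonical-length-minimal {n} {l} {v} canonical valid w≈v = begin
  length (word l)                    ≡⟨ inversions-canonical l canonical ⟨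
  inversions (2 + n) (perm (word l)) ≡⟨ inversions-cong (2 + n) (perm-respects-≈ w≈v) ⟩
  inversions (2 + n) (perm v)        ≤⟨ inversions-perm-≤-length v valid ⟩
  length v                           ∎
  where open ≤-Reasoning

canonical-≈⇒≈comm : ∀ {n} l v → Canonical n l → ValidWord n v → word l ≈⟨ n ⟩ v →
                    length v ≡ length (word l) → v ≈comm⟨ n ⟩ word l
canonical-≈⇒≈comm []      []      _         _                _    _   = refl []
canonical-≈⇒≈comm (_ ∷ _) []      _         _                _    ()
canonical-≈⇒≈comm {n} l   (b ∷ v) canonical (b-gen ∷ valid) w≈bv len =
  trans (Congr-++ˡ (b ∷ []) (canonical-≈⇒≈comm l′ v canonical′ valid w′≈v len′)) (sym w≈b∷w′)
  where
  long : length v < inversions (2 + n) (perm (b ∷ v))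
  long = begin-strict
    length v                           <⟨ n<1+n (length v) ⟩
    length (b ∷ v)                     ≡⟨ len ⟩
    length (word l)                    ≡⟨ inversions-canonical l canonical ⟨
    inversions (2 + n) (perm (word l)) ≡⟨ inversions-cong (2 + n) (perm-respects-≈ w≈bv) ⟩
    inversions (2 + n) (perm (b ∷ v))  ∎
    where open ≤-Reasoning

  descent : Descent (word l) b
  descent = Descent-respects-≈ (sym w≈bv)
    (subst₂ _<_ (cong (perm⁻¹ v) (≡.sym (swap-right b))) (cong (perm⁻¹ v) (≡.sym (swap-left b)))
            (length<inversions⇒ascent v b-gen valid long))

  movable : Movable l b
  movable = Descent⇒Movable l b canonical descent

  l′ : List (ℕ × ℕ)
  l′ = remove l movable

  canonical′ : Canonical n l′
  canonical′ = remove-canonical l movable canonical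

  w≈b∷w′ : word l ≈comm⟨ n ⟩ (b ∷ word l′)
  w≈b∷w′ = word≈comm-remove l movable canonical b-gen

  w′≈v : word l′ ≈⟨ n ⟩ v
  w′≈v = ≈-cancelˡ b-gen (trans (sym (≈comm⇒≈ w≈b∷w′)) w≈bv)

  len′ : length v ≡ length (word l′)
  len′ = suc-injective (≡.trans len (≈comm-length w≈b∷w′))

canonical-reduced : ∀ {n l} → Canonical n l → Reduced n (word l) (word l)
canonical-reduced {l = l} canonical =
  word-valid l (proj₁ canonical) , refl (word l) ,
  λ v valid w≈v → canonical-length-minimal canonical valid w≈v

canonical-hasLength : ∀ {n l} → Canonical n l → HasLength n (word l) (length (word l))
canonical-hasLength canonical = _ , canonical-reduced canonical , refl

canonical-reduced-length : ∀ {n l v} → Canonical n l → Reduced n (word l) v → length v ≡ length (word l)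
canonical-reduced-length {l = l} canonical (valid , w≈v , minimal) =
  ≤-antisym (minimal (word l) (word-valid l (proj₁ canonical)) (refl (word l)))
            (canonical-length-minimal canonical valid w≈v)

canonical-reduced⇒≈comm : ∀ {n l v} → Canonical n l → Reduced n (word l) v → v ≈comm⟨ n ⟩ word l
canonical-reduced⇒≈comm {l = l} {v} canonical reduced@(valid , w≈v , _) =
  canonical-≈⇒≈comm l v canonical valid w≈v (canonical-reduced-length canonical reduced)

canonical-isFC : ∀ {n l} → Canonical n l → IsFC n (word l)
canonical-isFC canonical v v′ reduced reduced′ =
  trans (canonical-reduced⇒≈comm canonical reduced) (sym (canonical-reduced⇒≈comm canonical reduced′))

-- The map w ↦ w̄

unbar : List (ℕ × ℕ) → List (ℕ × ℕ)
unbar = map (λ s → (proj₁ s , suc (proj₂ s)))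

bar-unbar : ∀ v → bar (unbar v) ≡ v
bar-unbar v = ≡.trans (≡.sym (map-∘ v)) (map-id v)

unbar-bar : ∀ {l} → Thick l → unbar (bar l) ≡ l
unbar-bar {l} thick = ≡.trans (≡.sym (map-∘ l)) (map-id-local (All.map suc∸1 thick))
  where
  suc∸1 : ∀ {s} → proj₁ s < proj₂ s → (proj₁ s , suc (proj₂ s ∸ 1)) ≡ s
  suc∸1 {_ , suc _} _ = refl

bar-injective : ∀ {l l′} → Thick l → Thick l′ → bar l ≡ bar l′ → l ≡ l′
bar-injective {l} {l′} thick thick′ bar≡bar′ = begin
  l                ≡⟨ unbar-bar thick ⟨
  unbar (bar l)    ≡⟨ cong unbar bar≡bar′ ⟩
  unbar (bar l′)   ≡⟨ unbar-bar thick′ ⟩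
  l′               ∎
  where open ≡-Reasoning

bar-SegOK : ∀ {m s} → SegOK (suc m) s × proj₁ s < proj₂ s → SegOK m (proj₁ s , proj₂ s ∸ 1)
bar-SegOK {s = _ , suc _} ((1≤i , _ , s≤s j≤m) , s≤s i≤j) = 1≤i , i≤j , j≤m

bar-linked : ∀ {l} → Linked Decr l → Thick l → Linked Decr (bar l)
bar-linked []  _ = []
bar-linked [-] _ = [-]
bar-linked {(_ , _) ∷ (_ , _) ∷ _} ((i′<i , j′<j) ∷ linked) (_ ∷ thick@(i′<j′ ∷ _)) =
  (i′<i , ∸-monoˡ-< j′<j (≤-trans (s≤s z≤n) i′<j′)) ∷ bar-linked linked thick

unbar-SegOK : ∀ {m s} → SegOK m s → SegOK (suc m) (proj₁ s , suc (proj₂ s))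
unbar-SegOK (1≤i , i≤j , j≤m) = 1≤i , m≤n⇒m≤1+n i≤j , s≤s j≤m

unbar-Decr : ∀ {x y} → Decr x y → Decr (proj₁ x , suc (proj₂ x)) (proj₁ y , suc (proj₂ y))
unbar-Decr {_ , _} {_ , _} (i′<i , j′<j) = i′<i , s≤s j′<j

unbar-thick : ∀ {m s} → SegOK m s → proj₁ s < suc (proj₂ s)
unbar-thick (_ , i≤j , _) = s≤s i≤j

length-seg : ∀ i j → length (seg (i , j)) ≡ suc (j ∸ i)
length-seg i j = ≡.trans (length-map (i +_) (applyUpTo (λ k → k) (suc (j ∸ i))))
                         (length-applyUpTo (λ k → k) (suc (j ∸ i)))

length-word-bar : ∀ {l} → Thick l → length (word l) ≡ length (word (bar l)) + length l
length-word-bar {[]}              []                = refl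
length-word-bar {(i , suc j) ∷ l} (s≤s i≤j ∷ thick) = begin
  length (seg (i , suc j) ++ word l)
    ≡⟨ length-++ (seg (i , suc j)) ⟩
  length (seg (i , suc j)) + length (word l)
    ≡⟨ cong₂ _+_ longer (length-word-bar thick) ⟩
  suc (length (seg (i , j))) + (length (word (bar l)) + length l)
    ≡⟨ rearrange (length (seg (i , j))) (length (word (bar l))) (length l) ⟩
  length (seg (i , j)) + length (word (bar l)) + suc (length l)
    ≡⟨ cong (_+ suc (length l)) (length-++ (seg (i , j))) ⟨
  length (seg (i , j) ++ word (bar l)) + suc (length l) ∎
  where
  open ≡-Reasoning
  longer : length (seg (i , suc j)) ≡ suc (length (seg (i , j)))
  longer = ≡.trans (length-seg i (suc j)) (cong suc (≡.trans (+-∸-assoc 1 i≤j) (≡.sym (length-seg i j))))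
  rearrange : ∀ a b c → suc a + (b + c) ≡ a + b + suc c
  rearrange = solve-∀

bar-canonical : ∀ {m p l} → IsThickCanon (suc m) p l → IsCanon m p (bar l)
bar-canonical {l = l} (_ , ((size , oks , linked) , _) , thick) =
  ≡.trans (length-map _ l) size , All-map⁺ (All.zipWith bar-SegOK (oks , thick)) , bar-linked linked thick

canonical⇒IsFCCanon : ∀ {n p l} → IsCanon n p l → IsFCCanon n p l
canonical⇒IsFCCanon canonical = canonical , canonical-isFC (proj₂ canonical)

bar-length : ∀ {m p l} → IsThickCanon (suc m) p l →
             Σ ℕ (λ k → HasLength m (word (bar l)) k × HasLength (suc m) (word l) (k + p))
bar-length {m} {l = l} w@(_ , ((size , canonical) , _) , thick) =
  length (word (bar l)) , canonical-hasLength (proj₂ (bar-canonical w)) ,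
  subst (HasLength (suc m) (word l)) (≡.trans (length-word-bar thick) (cong (length (word (bar l)) +_) size))
        (canonical-hasLength canonical)

bar-surjective : ∀ {m p v} → 1 ≤ p → IsCanon m p v →
                 Σ (List (ℕ × ℕ)) (λ l → IsThickCanon (suc m) p l × bar l ≡ v)
bar-surjective {m} {p} {v} 1≤p (size , oks , linked) =
  unbar v , (1≤p , canonical⇒IsFCCanon unbar-canonical , All-map⁺ (All.map unbar-thick oks)) , bar-unbar v
  where
  unbar-canonical : IsCanon (suc m) p (unbar v)
  unbar-canonical = ≡.trans (length-map _ v) size , All-map⁺ (All.map unbar-SegOK oks) ,
                    Linked-map⁺ (Linked.map unbar-Decr linked)

mainTheorem5 : (m : ℕ) →
    -- for every size p ≥ 1
    ((p : ℕ) → 1 ≤ p →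
      -- w̄ is the canonical form of an FC element of size p in W(A_{n-1}), and ℓ(w) = ℓ(w̄) + p
      ((l : List (ℕ × ℕ)) → IsThickCanon (suc m) p l →
        IsFCCanon m p (bar l) ×
        Σ ℕ (λ k → HasLength m (word (bar l)) k × HasLength (suc m) (word l) (k + p)))
      -- w ↦ w̄ is injective on A^{G,p}_n
      × ((l l' : List (ℕ × ℕ)) → IsThickCanon (suc m) p l → IsThickCanon (suc m) p l' →
          bar l ≡ bar l' → l ≡ l')
      -- w ↦ w̄ maps A^{G,p}_n onto A^{c,p}_{n-1}
      × ((v : List (ℕ × ℕ)) → IsFCCanon m p v →
          Σ (List (ℕ × ℕ)) (λ l → IsThickCanon (suc m) p l × bar l ≡ v)))
    -- consequently: a size-preserving bijection A^G_n → A^c_{n-1} ∖ {1}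
    × (((l : List (ℕ × ℕ)) (p : ℕ) → IsThickCanon (suc m) p l →
          (1 ≤ p) × IsFCCanon m p (bar l))
      × ((l l' : List (ℕ × ℕ)) (p p' : ℕ) → IsThickCanon (suc m) p l → IsThickCanon (suc m) p' l' →
          bar l ≡ bar l' → l ≡ l')
      × ((v : List (ℕ × ℕ)) (q : ℕ) → 1 ≤ q → IsFCCanon m q v →
          Σ (List (ℕ × ℕ)) (λ l → IsThickCanon (suc m) q l × bar l ≡ v)))
mainTheorem5 m =
  (λ p 1≤p → (λ l w → canonical⇒IsFCCanon (bar-canonical w) , bar-length w)
           , (λ l l′ w w′ → bar-injective (proj₂ (proj₂ w)) (proj₂ (proj₂ w′)))
           , (λ v v-FC → bar-surjective 1≤p (proj₁ v-FC)))
  , (λ l p w → proj₁ w , canonical⇒IsFCCanon (bar-canonical w))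
  , (λ l l′ p p′ w w′ → bar-injective (proj₂ (proj₂ w)) (proj₂ (proj₂ w′)))
  , (λ v q 1≤q v-FC → bar-surjective 1≤q (proj₁ v-FC))
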